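{- Let $G=(V,E)$ be an undirected graph with positive integer edge weights $w$, terminal set $T\subseteq V$, and perturbed weights $\widetilde w$ (as in the context). Let $\widetilde{\mathcal L}$ be a laminar family of Steiner cuts that contains every supreme set of $G$ with respect to $\widetilde w$, represented as a forest, and apply the first, second and third post-order traversals described in the context. Let $\mathcal R=\{R\subseteq T:\mu(R)\text{ is defined}\}$ be the family of supreme sets of $G$ (under $w$) projected onto the terminals. Then after the third post-order traversal the laminar forest is exactly $\{\widetilde{\mu}(R):R\in\mathcal R\}$. Moreover, $d(\mu(R))=d(\widetilde{\mu}(R))$ for all $R\in\mathcal R$.
   Context: Perturbation: with $m=|E|$, $N$ an integer larger than the sum of edge weights, $\widetilde w(u,v)=mN\,w(u,v)+r(u,v)$ with $r(u,v)\in\{1,\dots,N\}$. $d(X)$ (resp. $\widetilde d(X)$) is the total $w$- (resp. $\widetilde w$-) weight of edges with exactly one endpoint in $X$. A Steiner cut is $X\subseteq V$ with $X\cap T\neq\emptyset$, $T\not\subseteq X$; it is extreme under a weight function if every Steiner cut $Y\subsetneq X$ has strictly larger cut value. For $R\subseteq T$, $\mu(R)$ (resp. $\widetilde\mu(R)$) is the union of all $w$-extreme (resp. $\widetilde w$-extreme) sets $X$ with $X\cap T=R$, defined only if some exists; these are the supreme sets. A laminar family is represented as a forest where the parent of a set is the minimal set of the family properly containing it; removing a node $R$ makes its children children of its parent (or roots if $R$ is a root). First traversal (post-order): at node $R$, if some current child $W$ has $\widetilde d(W)\le\widetilde d(R)$, remove $R$. Second traversal (post-order): at node $R$, if $R$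 has a parent $W$ with $|W\cap T|=|R\cap T|$, remove $R$. Third traversal (post-order): at node $R$, if some current child $W$ has $d(W)\le d(R)$, remove $R$. -}

module Defs where

open import Data.Nat using (ℕ; zero; suc; _+_; _*_; _≤_; _<_; _<ᵇ_)
open import Data.Bool using (Bool; true; false; if_then_else_; _∧_; not)
open import Data.Fin using (Fin; toℕ)
open import Data.List using (List; []; _∷_; _++_; map; concatMap; filter; allFin; length)
open import Data.List.Membership.Propositional renaming (_∈_ to _∈L_)
open import Data.List.Relation.Binary.Permutation.Propositional using (_↭_)
open import Data.Vec using (lookup)
open import Data.Nat.ListAction using (sum)
open import Data.Vec.Properties using (≡-dec)
import Data.Bool.Properties as BoolP
open import Data.Fin.Subset using (Subset; _∈_; _∉_; _⊆_; _⊂_; _∩_; ∣_∣; Nonempty; Empty)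
open import Data.Product using (_×_; _,_; ∃; ∃₂; Σ)
open import Data.Sum using (_⊎_)
open import Relation.Nullary using (¬_; ¬?)
open import Relation.Binary.PropositionalEquality using (_≡_)
open import Function.Bundles using (_⇔_)

-- Weighted graphs on vertex set Fin n, given by a weight function.
-- {u,v} is an edge iff w u v > 0 (w symmetric, no loops).

Weights : ℕ → Set
Weights n = Fin n → Fin n → ℕ

Symmetric : ∀ {n} → Weights n → Set
Symmetric w = ∀ u v → w u v ≡ w v u

allPairs : (n : ℕ) → List (Fin n × Fin n)
allPairs n = concatMap (λ u → map (λ v → (u , v)) (allFin n)) (allFin n)

lowerPairs : (n : ℕ) → List (Fin n × Fin n)
lowerPairs n = filter (λ p → Data.Nat._<?_ (toℕ (Data.Product.proj₁ p)) (toℕ (Data.Product.proj₂ p))) (allPairs n)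
  where import Data.Nat ; import Data.Product

numEdges : ∀ {n} → Weights n → ℕ
numEdges {n} w = length (filter (λ p → Data.Nat._<?_ 0 (w (Data.Product.proj₁ p) (Data.Product.proj₂ p))) (lowerPairs n))
  where import Data.Nat ; import Data.Product

totalWeight : ∀ {n} → Weights n → ℕ
totalWeight {n} w = sum (map (λ p → w (Data.Product.proj₁ p) (Data.Product.proj₂ p)) (lowerPairs n))
  where import Data.Product

perturb : ∀ {n} → Weights n → Weights n → ℕ → Weights n
perturb w r N u v = numEdges w * N * w u v + r u v

-- cut value: total weight of edges with exactly one endpoint in X
-- (each such edge counted once, as the ordered pair (inside, outside))
cut : ∀ {n} → Weights n → Subset n → ℕ
cut {n} w X = sum (map term (allPairs n))
  where
  term : Fin n × Fin n → ℕ
  term (u , v) = if lookup X u ∧ not (lookup X v) then w u v else 0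

SteinerCut : ∀ {n} → Subset n → Subset n → Set
SteinerCut T X = Nonempty (X ∩ T) × ¬ (T ⊆ X)

Extreme : ∀ {n} → Subset n → (Subset n → ℕ) → Subset n → Set
Extreme T d X = SteinerCut T X × (∀ Y → SteinerCut T Y → Y ⊂ X → d X < d Y)

-- IsMu T d R S : mu(R) is defined (w.r.t. cut function d) and equals S,
-- i.e. S is the union of all d-extreme sets X with X ∩ T = R, and there is one.
IsMu : ∀ {n} → Subset n → (Subset n → ℕ) → Subset n → Subset n → Set
IsMu T d R S =
  (∃ λ X → Extreme T d X × (X ∩ T) ≡ R) ×
  (∀ X → Extreme T d X → (X ∩ T) ≡ R → X ⊆ S) ×
  (∀ v → v ∈ S → ∃ λ X → Extreme T d X × (X ∩ T) ≡ R × v ∈ X)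

-- Laminar families, represented as (duplicate-free) lists of sets.
-- The forest structure is determined by proper inclusion.

Laminar : ∀ {n} → List (Subset n) → Set
Laminar L = ∀ X Y → X ∈L L → Y ∈L L → (X ⊆ Y) ⊎ (Y ⊆ X) ⊎ Empty (X ∩ Y)

IsChild : ∀ {n} → List (Subset n) → Subset n → Subset n → Set
IsChild F W R = W ∈L F × W ⊂ R × (∀ Z → Z ∈L F → W ⊂ Z → ¬ (Z ⊂ R))

IsParent : ∀ {n} → List (Subset n) → Subset n → Subset n → Set
IsParent F W R = W ∈L F × R ⊂ W × (∀ Z → Z ∈L F → R ⊂ Z → ¬ (Z ⊂ W))

-- ord lists the nodes of the forest of F in post-order: it is a permutation
-- of F, and for each node R the (strict) descendants of R (= members of F
-- properly contained in R) form the block immediately preceding R.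
IsPostOrder : ∀ {n} → List (Subset n) → List (Subset n) → Set
IsPostOrder F ord =
  (ord ↭ F) ×
  (∀ pre R post → ord ≡ pre ++ (R ∷ post) →
     ∃₂ λ a b → pre ≡ a ++ b × (∀ X → (X ∈L b) ⇔ (X ∈L F × X ⊂ R)))

-- removing a node from the forest = removing the set from the family
remove : ∀ {n} → Subset n → List (Subset n) → List (Subset n)
remove R F = filter (λ X → ¬? (≡-dec BoolP._≟_ X R)) F

-- Run cond F ord F' : visiting the nodes in the order ord, starting from the
-- family F, and removing the visited node R whenever cond R (current family)
-- holds, ends with the family F'.
data Run {n} (cond : Subset n → List (Subset n) → Set) :
         List (Subset n) → List (Subset n) → List (Subset n) → Set where
  done : ∀ {F} → Run cond F [] F
  drop : ∀ {F R ord F'} → cond R F → Run cond (remove R F) ord F' → Run cond F (R ∷ ord) F'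
  keep : ∀ {F R ord F'} → ¬ cond R F → Run cond F ord F' → Run cond F (R ∷ ord) F'

cond1 : ∀ {n} → (Subset n → ℕ) → Subset n → List (Subset n) → Set
cond1 dt R F = ∃ λ W → IsChild F W R × dt W ≤ dt R

cond2 : ∀ {n} → Subset n → Subset n → List (Subset n) → Set
cond2 T R F = ∃ λ W → IsParent F W R × ∣ W ∩ T ∣ ≡ ∣ R ∩ T ∣

cond3 : ∀ {n} → (Subset n → ℕ) → Subset n → List (Subset n) → Set
cond3 d R F = ∃ λ W → IsChild F W R × d W ≤ d R

-- Extreme sets of a submodular function with the same terminals are closed under union
-- (uncrossing), so μ(R) is itself extreme, and it has the least cut among the Steiner cuts
-- that contain it and have terminals R. The r-part of any cut is at most m N, so
-- d X < d Y implies d~ X < d~ Y: every w-extreme set is w~-extreme, μ(R) ⊆ μ~(R), and the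
-- minimality gives d μ(R) = d μ~(R).
-- The sets μ~(R) survive the first two traversals. After the first, d~ strictly decreases
-- from children to parents; so for a remaining node X and the supreme set μ~ of an extreme
-- set inside X, laminarity leaves only μ~ = X, as X ⊂ μ~ is excluded by the second traversal.
-- The third traversal keeps every μ~(R) with μ(R) defined, since a child W with
-- d W ≤ d μ~(R) would uncross with μ(R). It keeps a node X only if some w-extreme Z ⊆ X with
-- d Z ≤ d X has the terminals of X: otherwise μ~(Z ∩ T) ⊂ X survives with
-- d μ~(Z ∩ T) = d μ(Z ∩ T) ≤ d X.
{-# OPTIONS --safe #-}
module Submission where

open import Defs
open import Data.Bool using (true; false; if_then_else_; _∧_; _∨_; not)
open import Data.Bool.Properties using () renaming (_≟_ to _≟ᵇ_)
open import Data.Empty using (⊥-elim)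
open import Data.Fin using (Fin; toℕ)
import Data.Fin.Properties as Finₚ
open import Data.Fin.Subset using (Subset; _∈_; _∉_; _⊆_; _⊂_; _⊃_; _∩_; _∪_; ∣_∣; Nonempty; Empty)
open import Data.Fin.Subset.Induction using (Acc; acc; ⊂-wellFounded; ⊃-wellFounded)
open import Data.Fin.Subset.Properties
  using (_∈?_; _⊆?_; _⊂?_; nonempty?; anySubset?; ⊆-refl; ⊆-antisym; ⊆-trans; p⊂q⇒p⊆q; p⊂q⇒∣p∣<∣q∣;
         p∩q⊆p; p∩q⊆q; x∈p∩q⁺; p⊆p∪q; q⊆p∪q; x∈p∪q⁻)
open import Data.List using (List; []; _∷_; _++_; map; concatMap; filter; allFin; length)
open import Data.List.Membership.Propositional using (find; lose) renaming (_∈_ to _∈L_; _∉_ to _∉L_)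
open import Data.List.Membership.Propositional.Properties using (∈-filter⁻; ∈-filter⁺; ∈-++⁺ʳ)
open import Data.List.Properties using (map-++; map-∘; map-cong)
open import Data.List.Relation.Binary.Permutation.Propositional using (↭-sym; ↭⇒↭ₛ)
open import Data.List.Relation.Binary.Permutation.Propositional.Properties using (∈-resp-↭)
import Data.List.Relation.Binary.Permutation.Setoid.Properties as Permutation
open import Data.List.Relation.Unary.All as All using (All)
open import Data.List.Relation.Unary.AllPairs using (_∷_)
open import Data.List.Relation.Unary.Any using (here; there; any?)
open import Data.List.Relation.Unary.Unique.Propositional using (Unique)
import Data.List.Relation.Unary.Unique.Propositional.Properties as Unique
open import Data.Nat using (ℕ; suc; _+_; _*_; _≤_; _<_; _≤?_; _<?_; _≟_; z≤n)
open import Data.Nat.Induction using (<-wellFounded)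
open import Data.Nat.ListAction using (sum)
open import Data.Nat.ListAction.Properties using (sum-++)
open import Data.Nat.Properties
open import Algebra.Properties.CommutativeSemigroup +-commutativeSemigroup using (interchange)
open import Data.Product using (_×_; _,_; ∃; proj₁; proj₂; map₂; swap)
open import Data.Sum using (_⊎_; inj₁; inj₂; [_,_]′)
open import Data.Vec using (lookup)
open import Data.Vec.Properties using (≡-dec; lookup-zipWith)
open import Function using (id; _∘_)
open import Function.Bundles using (Equivalence)
open import Relation.Binary.Definitions using (tri<; tri≈; tri>)
open import Relation.Binary.PropositionalEquality using (_≡_; _≢_; refl; sym; trans; cong; cong₂; subst; module ≡-Reasoning)
open import Relation.Binary.PropositionalEquality.Properties using (setoid)
open import Relation.Nullary using (¬_; ¬?; Dec; yes; no; does; contradiction)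
open import Relation.Nullary.Decidable using (_×-dec_; decidable-stable; dec-true)

private variable
  n : ℕ
  A B : Set
  p q r : Subset n
  x t : Fin n
  F F' F₀ G o : List (Subset n)
  R M S S~ T W X Y Z : Subset n

infix 4 _≟ˢ_
_≟ˢ_ : (p q : Subset n) → Dec (p ≡ q)
_≟ˢ_ = ≡-dec _≟ᵇ_

⊈⇒∃∉ : ¬ p ⊆ q → ∃ λ x → x ∈ p × x ∉ q
⊈⇒∃∉ {p = p} {q} p⊈q with Finₚ.any? (λ x → (x ∈? p) ×-dec ¬? (x ∈? q))
... | yes w = w
... | no ∄ = contradiction (λ {x} x∈p → decidable-stable (x ∈? q) (λ x∉q → ∄ (x , x∈p , x∉q))) p⊈q

⊆⇒≡⊎⊂ : p ⊆ q → p ≡ q ⊎ p ⊂ q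
⊆⇒≡⊎⊂ {p = p} {q} p⊆q with q ⊆? p
... | yes q⊆p = inj₁ (⊆-antisym p⊆q q⊆p)
... | no q⊈p = inj₂ (p⊆q , ⊈⇒∃∉ q⊈p)

⊆∧⊄⇒≡ : p ⊆ q → ¬ p ⊂ q → p ≡ q
⊆∧⊄⇒≡ p⊆q p⊄q with ⊆⇒≡⊎⊂ p⊆q
... | inj₁ p≡q = p≡q
... | inj₂ p⊂q = contradiction p⊂q p⊄q

⊆∧∣≡∣⇒≡ : p ⊆ q → ∣ p ∣ ≡ ∣ q ∣ → p ≡ q
⊆∧∣≡∣⇒≡ p⊆q ∣p∣≡∣q∣ = ⊆∧⊄⇒≡ p⊆q λ p⊂q → <⇒≢ (p⊂q⇒∣p∣<∣q∣ p⊂q) ∣p∣≡∣q∣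

∩-⊆ˡ : p ∩ q ⊆ p
∩-⊆ˡ {p = p} {q} = p∩q⊆p p q

∩-⊆ʳ : p ∩ q ⊆ q
∩-⊆ʳ {p = p} {q} = p∩q⊆q p q

∈-∩⁺ : x ∈ p → x ∈ q → x ∈ p ∩ q
∈-∩⁺ x∈p x∈q = x∈p∩q⁺ (x∈p , x∈q)

∪-⊆ˡ : p ⊆ p ∪ q
∪-⊆ˡ {q = q} = p⊆p∪q q

∪-⊆ʳ : q ⊆ p ∪ q
∪-⊆ʳ {q = q} {p = p} = q⊆p∪q p q

∪-lub : p ⊆ r → q ⊆ r → p ∪ q ⊆ r
∪-lub {p = p} {q = q} p⊆r q⊆r x∈p∪q with x∈p∪q⁻ p q x∈p∪q
... | inj₁ x∈p = p⊆r x∈p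
... | inj₂ x∈q = q⊆r x∈q

∩-monoˡ-⊆ : p ⊆ q → p ∩ r ⊆ q ∩ r
∩-monoˡ-⊆ p⊆q x∈p∩r = ∈-∩⁺ (p⊆q (∩-⊆ˡ x∈p∩r)) (∩-⊆ʳ x∈p∩r)

-- Extreme and supreme sets of a submodular function

module Submodular {n} (T : Subset n) (f : Subset n → ℕ)
  (submodular : ∀ X Y → f (X ∩ Y) + f (X ∪ Y) ≤ f X + f Y) where

  open ≤-Reasoning

  steinerCut? : ∀ X → Dec (SteinerCut T X)
  steinerCut? X = nonempty? (X ∩ T) ×-dec ¬? (T ⊆? X)

  steinerCut-⊆ : X ⊆ Y → t ∈ X → t ∈ T → SteinerCut T Y → SteinerCut T X
  steinerCut-⊆ X⊆Y t∈X t∈T (_ , T⊈Y) = (_ , ∈-∩⁺ t∈X t∈T) , λ T⊆X → T⊈Y (⊆-trans T⊆X X⊆Y)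

  steinerCut-between : X ⊆ Y → Y ⊆ Z → SteinerCut T X → SteinerCut T Z → SteinerCut T Y
  steinerCut-between X⊆Y Y⊆Z ((t , t∈X∩T) , _) (_ , T⊈Z) =
    (t , ∩-monoˡ-⊆ X⊆Y t∈X∩T) , λ T⊆Y → T⊈Z (⊆-trans T⊆Y Y⊆Z)

  smallerSteinerCut? : ∀ X → Dec (∃ λ Y → SteinerCut T Y × Y ⊂ X × f Y ≤ f X)
  smallerSteinerCut? X = anySubset? λ Y → steinerCut? Y ×-dec (Y ⊂? X) ×-dec (f Y ≤? f X)

  extreme-≤ : Extreme T f X → SteinerCut T Y → Y ⊆ X → f X ≤ f Y
  extreme-≤ eX sY Y⊆X with ⊆⇒≡⊎⊂ Y⊆X
  ... | inj₁ refl = ≤-refl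
  ... | inj₂ Y⊂X = <⇒≤ (proj₂ eX _ sY Y⊂X)

  ∄smaller⇒extreme : SteinerCut T X → ¬ (∃ λ Y → SteinerCut T Y × Y ⊂ X × f Y ≤ f X) → Extreme T f X
  ∄smaller⇒extreme sX ∄ = sX , λ Y sY Y⊂X → ≰⇒> λ fY≤fX → ∄ (Y , sY , Y⊂X , fY≤fX)

  extreme? : ∀ X → Dec (Extreme T f X)
  extreme? X with steinerCut? X | smallerSteinerCut? X
  ... | no ¬sX | _ = no (¬sX ∘ proj₁)
  ... | yes _ | yes (Y , sY , Y⊂X , fY≤fX) = no λ eX → <⇒≱ (proj₂ eX Y sY Y⊂X) fY≤fX
  ... | yes sX | no ∄ = yes (∄smaller⇒extreme sX ∄)

  extreme-below : SteinerCut T X → ∃ λ Z → Extreme T f Z × Z ⊆ X × f Z ≤ f X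
  extreme-below {X = X} = go X (⊂-wellFounded X)
    where
    go : ∀ X → Acc _⊂_ X → SteinerCut T X → ∃ λ Z → Extreme T f Z × Z ⊆ X × f Z ≤ f X
    go X (acc rec) sX with smallerSteinerCut? X
    ... | yes (Y , sY , Y⊂X , fY≤fX) =
      let Z , eZ , Z⊆Y , fZ≤fY = go Y (rec Y⊂X) sY
      in Z , eZ , ⊆-trans Z⊆Y (p⊂q⇒p⊆q Y⊂X) , ≤-trans fZ≤fY fY≤fX
    ... | no ∄ = X , ∄smaller⇒extreme sX ∄ , id , ≤-refl

  -- Submodularity: f X < f (X ∩ Y) forces f (X ∪ Y) < f Y.
  uncross : Extreme T f X → t ∈ X → t ∈ Y → t ∈ T → ¬ X ⊆ Y → f (X ∪ Y) < f Y
  uncross {X = X} {Y = Y} (sX , belowX) t∈X t∈Y t∈T X⊈Y =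
    +-cancelˡ-< (f X) _ _ (<-≤-trans (+-monoˡ-< (f (X ∪ Y)) fX<fX∩Y) (submodular X Y))
    where
    X∩Y⊂X : X ∩ Y ⊂ X
    X∩Y⊂X = let x , x∈X , x∉Y = ⊈⇒∃∉ X⊈Y in ∩-⊆ˡ , x , x∈X , x∉Y ∘ ∩-⊆ʳ
    fX<fX∩Y : f X < f (X ∩ Y)
    fX<fX∩Y = belowX (X ∩ Y) (steinerCut-⊆ ∩-⊆ˡ (∈-∩⁺ t∈X t∈Y) t∈T sX) X∩Y⊂X

  uncross-≤ : Extreme T f X → t ∈ X → t ∈ Y → t ∈ T → f (X ∪ Y) ≤ f Y
  uncross-≤ {X = X} {Y = Y} eX t∈X t∈Y t∈T with X ⊆? Y
  ... | yes X⊆Y = ≤-reflexive (cong f (⊆-antisym (∪-lub X⊆Y id) ∪-⊆ʳ))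
  ... | no X⊈Y = <⇒≤ (uncross eX t∈X t∈Y t∈T X⊈Y)

  terminals-between : X ⊆ Y → Y ⊆ Z → X ∩ T ≡ R → Z ∩ T ≡ R → Y ∩ T ≡ R
  terminals-between {R = R} X⊆Y Y⊆Z X∩T≡R Z∩T≡R =
    ⊆-antisym (subst (_ ⊆_) Z∩T≡R (∩-monoˡ-⊆ Y⊆Z)) (subst (_⊆ _) X∩T≡R (∩-monoˡ-⊆ X⊆Y))

  ∈-∪-terminal : X ∩ T ≡ Y ∩ T → t ∈ X ∪ Y → t ∈ T → t ∈ X × t ∈ Y
  ∈-∪-terminal {X = X} {Y = Y} {t = t} X∩T≡Y∩T t∈X∪Y t∈T with x∈p∪q⁻ X Y t∈X∪Y
  ... | inj₁ t∈X = t∈X , ∩-⊆ˡ (subst (t ∈_) X∩T≡Y∩T (∈-∩⁺ t∈X t∈T))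
  ... | inj₂ t∈Y = ∩-⊆ˡ (subst (t ∈_) (sym X∩T≡Y∩T) (∈-∩⁺ t∈Y t∈T)) , t∈Y

  ∪-terminals : X ∩ T ≡ R → Y ∩ T ≡ R → (X ∪ Y) ∩ T ≡ R
  ∪-terminals {X = X} {R = R} X∩T≡R Y∩T≡R = ⊆-antisym
    (λ t∈X∪Y∩T → subst (_ ∈_) X∩T≡R (∈-∩⁺ (proj₁ (∈-∪-terminal (trans X∩T≡R (sym Y∩T≡R)) (∩-⊆ˡ t∈X∪Y∩T) (∩-⊆ʳ t∈X∪Y∩T))) (∩-⊆ʳ t∈X∪Y∩T)))
    (λ t∈R → ∩-monoˡ-⊆ ∪-⊆ˡ (subst (_ ∈_) (sym X∩T≡R) t∈R))

  extreme-∪ : Extreme T f X → Extreme T f Y → X ∩ T ≡ Y ∩ T → Extreme T f (X ∪ Y)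
  extreme-∪ {X = X} {Y = Y} eX@(sX , _) eY X∩T≡Y∩T = steinerCut , below
    where
    steinerCut : SteinerCut T (X ∪ Y)
    steinerCut = (_ , ∩-monoˡ-⊆ ∪-⊆ˡ (proj₂ (proj₁ sX)))
               , λ T⊆X∪Y → proj₂ sX λ t∈T → proj₁ (∈-∪-terminal X∩T≡Y∩T (T⊆X∪Y t∈T) t∈T)

    below-sharing : Z ⊂ X ∪ Y → t ∈ X → t ∈ Y → t ∈ Z → t ∈ T → f (X ∪ Y) < f Z
    below-sharing {Z = Z} (Z⊆X∪Y , v , v∈X∪Y , v∉Z) t∈X t∈Y t∈Z t∈T with X ⊆? Z
    ... | yes X⊆Z = begin-strict
      f (X ∪ Y)  ≡⟨ cong f (⊆-antisym (∪-lub (⊆-trans X⊆Z ∪-⊆ʳ) ∪-⊆ˡ) (∪-lub ∪-⊆ʳ Z⊆X∪Y)) ⟩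
      f (Y ∪ Z)  <⟨ uncross eY t∈Y t∈Z t∈T (λ Y⊆Z → v∉Z (∪-lub X⊆Z Y⊆Z v∈X∪Y)) ⟩
      f Z        ∎
    ... | no X⊈Z = begin-strict
      f (X ∪ Y)        ≡⟨ cong f (⊆-antisym (∪-lub (⊆-trans ∪-⊆ˡ ∪-⊆ʳ) ∪-⊆ˡ) (∪-lub ∪-⊆ʳ (∪-lub ∪-⊆ˡ Z⊆X∪Y))) ⟩
      f (Y ∪ (X ∪ Z))  ≤⟨ uncross-≤ eY t∈Y (∪-⊆ʳ t∈Z) t∈T ⟩
      f (X ∪ Z)        <⟨ uncross eX t∈X t∈Z t∈T X⊈Z ⟩
      f Z              ∎

    below : ∀ Z → SteinerCut T Z → Z ⊂ X ∪ Y → f (X ∪ Y) < f Z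
    below Z ((t , t∈Z∩T) , _) Z⊂X∪Y@(Z⊆X∪Y , _) =
      let t∈X , t∈Y = ∈-∪-terminal X∩T≡Y∩T (Z⊆X∪Y (∩-⊆ˡ t∈Z∩T)) (∩-⊆ʳ t∈Z∩T)
      in below-sharing Z⊂X∪Y t∈X t∈Y (∩-⊆ˡ t∈Z∩T) (∩-⊆ʳ t∈Z∩T)

  Supreme : Subset n → Subset n → Set
  Supreme R M = Extreme T f M × M ∩ T ≡ R × (∀ Y → Extreme T f Y → Y ∩ T ≡ R → Y ⊆ M)

  supreme-above : Extreme T f X → X ∩ T ≡ R → ∃ λ M → Supreme R M × X ⊆ M
  supreme-above {X = X} = go X (⊃-wellFounded X)
    where
    go : ∀ X → Acc _⊃_ X → Extreme T f X → X ∩ T ≡ R → ∃ λ M → Supreme R M × X ⊆ M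
    go {R = R} X (acc rec) eX X∩T≡R
      with anySubset? (λ Y → extreme? Y ×-dec (Y ∩ T ≟ˢ R) ×-dec ¬? (Y ⊆? X))
    ... | yes (Y , eY , Y∩T≡R , Y⊈X) =
      let y , y∈Y , y∉X = ⊈⇒∃∉ Y⊈X
          M , supM , X∪Y⊆M = go (X ∪ Y) (rec (∪-⊆ˡ , y , ∪-⊆ʳ y∈Y , y∉X))
                               (extreme-∪ eX eY (trans X∩T≡R (sym Y∩T≡R)))
                               (∪-terminals X∩T≡R Y∩T≡R)
      in M , supM , ⊆-trans ∪-⊆ˡ X∪Y⊆M
    ... | no ∄ = X , (eX , X∩T≡R , λ Y eY Y∩T≡R → decidable-stable (Y ⊆? X) λ Y⊈X → ∄ (Y , eY , Y∩T≡R , Y⊈X)) , id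

  Supreme⇒IsMu : Supreme R M → IsMu T f R M
  Supreme⇒IsMu (eM , M∩T≡R , maxM) = (_ , eM , M∩T≡R) , maxM , λ _ v∈M → _ , eM , M∩T≡R , v∈M

  IsMu⇒Supreme : IsMu T f R M → Supreme R M
  IsMu⇒Supreme {R = R} {M = M} ((X , eX , X∩T≡R) , maxM , covered) with supreme-above eX X∩T≡R
  ... | M' , supM'@(eM' , M'∩T≡R , maxM') , _ = subst (Supreme R) M'≡M supM'
    where
    M'≡M : M' ≡ M
    M'≡M = ⊆-antisym (maxM M' eM' M'∩T≡R)
                     (λ v∈M → let Y , eY , Y∩T≡R , v∈Y = covered _ v∈M in maxM' Y eY Y∩T≡R v∈Y)

  supreme-≤ : Supreme R M → SteinerCut T W → M ⊆ W → W ∩ T ≡ R → f M ≤ f W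
  supreme-≤ {R = R} {M = M} (eM , M∩T≡R , maxM) sW = go _ (<-wellFounded (f _)) sW
    where
    go : ∀ W → Acc _<_ (f W) → SteinerCut T W → M ⊆ W → W ∩ T ≡ R → f M ≤ f W
    go W (acc rec) sW M⊆W W∩T≡R with extreme-below sW
    ... | Z , eZ@(((t , t∈Z∩T) , _) , _) , Z⊆W , fZ≤fW with M ⊆? Z
    ...   | yes M⊆Z = ≤-trans (extreme-≤ eM (proj₁ eZ) (maxM Z eZ Z∩T≡R)) fZ≤fW
      where
      Z∩T≡R : Z ∩ T ≡ R
      Z∩T≡R = terminals-between M⊆Z Z⊆W M∩T≡R W∩T≡R
    ...   | no M⊈Z = ≤-trans (go (M ∪ Z) (rec fM∪Z<fW) sM∪Z ∪-⊆ˡ M∪Z∩T≡R) (<⇒≤ fM∪Z<fW)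
      where
      M∪Z⊆W : M ∪ Z ⊆ W
      M∪Z⊆W = ∪-lub M⊆W Z⊆W
      sM∪Z : SteinerCut T (M ∪ Z)
      sM∪Z = steinerCut-between ∪-⊆ˡ M∪Z⊆W (proj₁ eM) sW
      M∪Z∩T≡R : (M ∪ Z) ∩ T ≡ R
      M∪Z∩T≡R = terminals-between ∪-⊆ˡ M∪Z⊆W M∩T≡R W∩T≡R
      t∈M : t ∈ M
      t∈M = ∩-⊆ˡ (subst (t ∈_) (sym M∩T≡R) (subst (t ∈_) W∩T≡R (∩-monoˡ-⊆ Z⊆W t∈Z∩T)))
      fM∪Z<fW : f (M ∪ Z) < f W
      fM∪Z<fW = <-≤-trans (uncross eM t∈M (∩-⊆ˡ t∈Z∩T) (∩-⊆ʳ t∈Z∩T) M⊈Z) fZ≤fW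

  Supreme-own-terminals : Supreme R M → Supreme (M ∩ T) M
  Supreme-own-terminals {M = M} supM@(_ , M∩T≡R , _) = subst (λ Q → Supreme Q M) (sym M∩T≡R) supM

sum-map-+ : ∀ (f g : A → ℕ) xs → sum (map (λ x → f x + g x) xs) ≡ sum (map f xs) + sum (map g xs)
sum-map-+ f g [] = refl
sum-map-+ f g (x ∷ xs) =
  trans (cong (f x + g x +_) (sum-map-+ f g xs)) (interchange (f x) (g x) _ _)

sum-map-* : ∀ k (f : A → ℕ) xs → sum (map (λ x → k * f x) xs) ≡ k * sum (map f xs)
sum-map-* k f [] = sym (*-zeroʳ k)
sum-map-* k f (x ∷ xs) =
  trans (cong (k * f x +_) (sum-map-* k f xs)) (sym (*-distribˡ-+ k (f x) _))

sum-map-zero : ∀ (xs : List A) → sum (map (λ _ → 0) xs) ≡ 0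
sum-map-zero [] = refl
sum-map-zero (x ∷ xs) = sum-map-zero xs

sum-map-mono-≤ : ∀ {f g : A → ℕ} → (∀ x → f x ≤ g x) → ∀ xs → sum (map f xs) ≤ sum (map g xs)
sum-map-mono-≤ f≤g [] = z≤n
sum-map-mono-≤ f≤g (x ∷ xs) = +-mono-≤ (f≤g x) (sum-map-mono-≤ f≤g xs)

sum-map-positive : ∀ {f g : A → ℕ} → (∀ x → 0 < f x → 0 < g x) →
                   ∀ xs → 0 < sum (map f xs) → 0 < sum (map g xs)
sum-map-positive {f = f} {g} f⇒g (x ∷ xs) 0<Σf with f x ≟ 0
... | yes fx≡0 = ≤-trans (sum-map-positive f⇒g xs (subst (λ y → 0 < y + sum (map f xs)) fx≡0 0<Σf))
                                  (m≤n+m _ (g x))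
... | no fx≢0 = ≤-trans (f⇒g x (n≢0⇒n>0 fx≢0)) (m≤m+n (g x) _)

sum-map-filter : ∀ {P : A → Set} (P? : ∀ x → Dec (P x)) (f : A → ℕ) xs →
                 sum (map f (filter P? xs)) ≡ sum (map (λ x → if does (P? x) then f x else 0) xs)
sum-map-filter P? f [] = refl
sum-map-filter P? f (x ∷ xs) with does (P? x)
... | true = cong (f x +_) (sum-map-filter P? f xs)
... | false = sum-map-filter P? f xs

length≡sum-map-1 : ∀ (xs : List A) → length xs ≡ sum (map (λ _ → 1) xs)
length≡sum-map-1 [] = refl
length≡sum-map-1 (x ∷ xs) = cong suc (length≡sum-map-1 xs)

sum-map-concatMap : ∀ (f : A → ℕ) (h : B → List A) ys →
                    sum (map f (concatMap h ys)) ≡ sum (map (λ y → sum (map f (h y))) ys)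
sum-map-concatMap f h [] = refl
sum-map-concatMap f h (y ∷ ys) = begin
  sum (map f (h y ++ concatMap h ys))
    ≡⟨ cong sum (map-++ f (h y) _) ⟩
  sum (map f (h y) ++ map f (concatMap h ys))
    ≡⟨ sum-++ (map f (h y)) _ ⟩
  sum (map f (h y)) + sum (map f (concatMap h ys))
    ≡⟨ cong (sum (map f (h y)) +_) (sum-map-concatMap f h ys) ⟩
  sum (map f (h y)) + sum (map (λ y → sum (map f (h y))) ys)
    ∎
  where open ≡-Reasoning

sum-map-comm : ∀ (g : A → B → ℕ) xs ys →
               sum (map (λ x → sum (map (g x) ys)) xs) ≡ sum (map (λ y → sum (map (λ x → g x y) xs)) ys)
sum-map-comm g [] ys = sym (sum-map-zero ys)
sum-map-comm g (x ∷ xs) ys =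
  trans (cong (sum (map (g x) ys) +_) (sum-map-comm g xs ys)) (sym (sum-map-+ (g x) _ ys))

sum-allPairs : ∀ (f : Fin n × Fin n → ℕ) →
               sum (map f (allPairs n)) ≡ sum (map (λ u → sum (map (λ v → f (u , v)) (allFin n))) (allFin n))
sum-allPairs {n} f = trans (sum-map-concatMap f _ (allFin n))
  (cong sum (map-cong (λ u → cong sum (sym (map-∘ (allFin n)))) (allFin n)))

sum-allPairs-swap : ∀ (f : Fin n × Fin n → ℕ) → sum (map (f ∘ swap) (allPairs n)) ≡ sum (map f (allPairs n))
sum-allPairs-swap {n} f = begin
  sum (map (f ∘ swap) (allPairs n))
    ≡⟨ sum-allPairs (f ∘ swap) ⟩
  sum (map (λ u → sum (map (λ v → f (v , u)) (allFin n))) (allFin n))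
    ≡⟨ sum-map-comm (λ u v → f (v , u)) (allFin n) (allFin n) ⟩
  sum (map (λ v → sum (map (λ u → f (v , u)) (allFin n))) (allFin n))
    ≡⟨ sym (sum-allPairs f) ⟩
  sum (map f (allPairs n))
    ∎
  where open ≡-Reasoning

-- Cut functions

cutTerm : Weights n → Subset n → Fin n × Fin n → ℕ
cutTerm w X (u , v) = if lookup X u ∧ not (lookup X v) then w u v else 0

crossing-submodular : ∀ a b c e k →
  (if (a ∧ c) ∧ not (b ∧ e) then k else 0) + (if (a ∨ c) ∧ not (b ∨ e) then k else 0)
    ≤ (if a ∧ not b then k else 0) + (if c ∧ not e then k else 0)
crossing-submodular true  true  true  true  k = z≤n
crossing-submodular true  true  true  false k = ≤-reflexive (+-comm k 0)
crossing-submodular true  true  false true  k = z≤n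
crossing-submodular true  true  false false k = z≤n
crossing-submodular true  false true  true  k = ≤-refl
crossing-submodular true  false true  false k = ≤-refl
crossing-submodular true  false false true  k = z≤n
crossing-submodular true  false false false k = ≤-reflexive (+-comm 0 k)
crossing-submodular false true  true  true  k = z≤n
crossing-submodular false true  true  false k = z≤n
crossing-submodular false true  false true  k = z≤n
crossing-submodular false true  false false k = z≤n
crossing-submodular false false true  true  k = z≤n
crossing-submodular false false true  false k = ≤-refl
crossing-submodular false false false true  k = z≤n
crossing-submodular false false false false k = z≤n

cut-submodular : ∀ (w : Weights n) X Y → cut w (X ∩ Y) + cut w (X ∪ Y) ≤ cut w X + cut w Y
cut-submodular {n} w X Y = begin
  cut w (X ∩ Y) + cut w (X ∪ Y)
    ≡⟨ sum-map-+ (cutTerm w (X ∩ Y)) _ (allPairs n) ⟨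
  sum (map (λ p → cutTerm w (X ∩ Y) p + cutTerm w (X ∪ Y) p) (allPairs n))
    ≤⟨ sum-map-mono-≤ pointwise (allPairs n) ⟩
  sum (map (λ p → cutTerm w X p + cutTerm w Y p) (allPairs n))
    ≡⟨ sum-map-+ (cutTerm w X) _ (allPairs n) ⟩
  cut w X + cut w Y
    ∎
  where
  open ≤-Reasoning
  pointwise : ∀ p → cutTerm w (X ∩ Y) p + cutTerm w (X ∪ Y) p ≤ cutTerm w X p + cutTerm w Y p
  pointwise (u , v)
    rewrite lookup-zipWith _∧_ u X Y | lookup-zipWith _∧_ v X Y
          | lookup-zipWith _∨_ u X Y | lookup-zipWith _∨_ v X Y
    = crossing-submodular (lookup X u) (lookup X v) (lookup Y u) (lookup Y v) (w u v)

cut-perturb : ∀ (w r : Weights n) N X → cut (perturb w r N) X ≡ numEdges w * N * cut w X + cut r X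
cut-perturb {n} w r N X = begin
  cut (perturb w r N) X
    ≡⟨ cong sum (map-cong pointwise (allPairs n)) ⟩
  sum (map (λ p → k * cutTerm w X p + cutTerm r X p) (allPairs n))
    ≡⟨ sum-map-+ (λ p → k * cutTerm w X p) _ (allPairs n) ⟩
  sum (map (λ p → k * cutTerm w X p) (allPairs n)) + cut r X
    ≡⟨ cong (_+ cut r X) (sum-map-* k (cutTerm w X) (allPairs n)) ⟩
  k * cut w X + cut r X
    ∎
  where
  open ≡-Reasoning
  k : ℕ
  k = numEdges w * N
  pointwise : ∀ p → cutTerm (perturb w r N) X p ≡ k * cutTerm w X p + cutTerm r X p
  pointwise (u , v) with lookup X u ∧ not (lookup X v)
  ... | true = refl
  ... | false = cong (_+ 0) (sym (*-zeroʳ k))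

cut-positive : ∀ (w r : Weights n) → (∀ u v → 0 < w u v → 0 < r u v) → ∀ X → 0 < cut w X → 0 < cut r X
cut-positive {n} w r w⇒r X = sum-map-positive pointwise (allPairs n)
  where
  pointwise : ∀ p → 0 < cutTerm w X p → 0 < cutTerm r X p
  pointwise (u , v) with lookup X u ∧ not (lookup X v)
  ... | true = w⇒r u v
  ... | false = λ ()

module Perturbation (w r : Weights n) (N : ℕ) (w-sym : Symmetric w) (w-loopless : ∀ u → w u u ≡ 0)
  (r-off : ∀ u v → w u v ≡ 0 → r u v ≡ 0) (r-on : ∀ u v → 0 < w u v → 1 ≤ r u v × r u v ≤ N) where

  isEdge : Fin n × Fin n → ℕ
  isEdge (u , v) = if does (toℕ u <? toℕ v) then (if does (0 <? w u v) then 1 else 0) else 0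

  numEdges≡sum-isEdge : numEdges w ≡ sum (map isEdge (allPairs n))
  numEdges≡sum-isEdge = begin
    numEdges w
      ≡⟨ length≡sum-map-1 (filter edge? (filter lower? (allPairs n))) ⟩
    sum (map (λ _ → 1) (filter edge? (filter lower? (allPairs n))))
      ≡⟨ sum-map-filter edge? (λ _ → 1) (filter lower? (allPairs n)) ⟩
    sum (map (λ p → if does (edge? p) then 1 else 0) (filter lower? (allPairs n)))
      ≡⟨ sum-map-filter lower? _ (allPairs n) ⟩
    sum (map isEdge (allPairs n))
      ∎
    where
    open ≡-Reasoning
    lower? : ∀ (p : Fin n × Fin n) → Dec (toℕ (proj₁ p) < toℕ (proj₂ p))
    lower? p = toℕ (proj₁ p) <? toℕ (proj₂ p)
    edge? : ∀ (p : Fin n × Fin n) → Dec (0 < w (proj₁ p) (proj₂ p))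
    edge? p = 0 <? w (proj₁ p) (proj₂ p)

  r-≤-isEdge : ∀ u v → r u v ≤ N * isEdge (u , v) + N * isEdge (v , u)
  r-≤-isEdge u v with w u v ≟ 0
  ... | yes wuv≡0 rewrite r-off u v wuv≡0 = z≤n
  ... | no wuv≢0 with <-cmp (toℕ u) (toℕ v)
  ...   | tri< u<v _ _
          rewrite dec-true (toℕ u <? toℕ v) u<v | dec-true (0 <? w u v) (n≢0⇒n>0 wuv≢0)
          = ≤-trans (proj₂ (r-on u v (n≢0⇒n>0 wuv≢0))) (≤-trans (≤-reflexive (sym (*-identityʳ N))) (m≤m+n _ _))
  ...   | tri≈ _ u≡v _ = contradiction (trans (cong (w u) (sym (Finₚ.toℕ-injective u≡v))) (w-loopless u)) wuv≢0
  ...   | tri> _ _ v<u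
          rewrite dec-true (toℕ v <? toℕ u) v<u | dec-true (0 <? w v u) (subst (0 <_) (w-sym u v) (n≢0⇒n>0 wuv≢0))
          = ≤-trans (proj₂ (r-on u v (n≢0⇒n>0 wuv≢0))) (≤-trans (≤-reflexive (sym (*-identityʳ N))) (m≤n+m _ _))

  cutTerm-r-≤ : ∀ X p → cutTerm r X p + cutTerm r X (swap p) ≤ N * isEdge p + N * isEdge (swap p)
  cutTerm-r-≤ X (u , v) with lookup X u | lookup X v
  ... | true  | true  = z≤n
  ... | false | false = z≤n
  ... | true  | false = ≤-trans (≤-reflexive (+-identityʳ (r u v))) (r-≤-isEdge u v)
  ... | false | true  = ≤-trans (r-≤-isEdge v u) (≤-reflexive (+-comm (N * isEdge (v , u)) _))

  -- Each edge crosses the cut at most once, and then contributes at most N.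
  cut-r-≤ : ∀ X → cut r X ≤ numEdges w * N
  cut-r-≤ X = m+m≤n+n⇒m≤n (begin
    cut r X + cut r X
      ≡⟨ cong (cut r X +_) (sum-allPairs-swap (cutTerm r X)) ⟨
    cut r X + sum (map (cutTerm r X ∘ swap) (allPairs n))
      ≡⟨ sum-map-+ (cutTerm r X) _ (allPairs n) ⟨
    sum (map (λ p → cutTerm r X p + cutTerm r X (swap p)) (allPairs n))
      ≤⟨ sum-map-mono-≤ (cutTerm-r-≤ X) (allPairs n) ⟩
    sum (map (λ p → N * isEdge p + N * isEdge (swap p)) (allPairs n))
      ≡⟨ sum-map-+ (λ p → N * isEdge p) _ (allPairs n) ⟩
    Nm + sum (map ((λ p → N * isEdge p) ∘ swap) (allPairs n))
      ≡⟨ cong (Nm +_) (sum-allPairs-swap (λ p → N * isEdge p)) ⟩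
    Nm + Nm
      ≡⟨ cong₂ _+_ Nm≡mN Nm≡mN ⟩
    numEdges w * N + numEdges w * N
      ∎)
    where
    open ≤-Reasoning
    Nm : ℕ
    Nm = sum (map (λ p → N * isEdge p) (allPairs n))
    Nm≡mN : Nm ≡ numEdges w * N
    Nm≡mN = trans (sum-map-* N isEdge (allPairs n)) (trans (cong (N *_) (sym numEdges≡sum-isEdge)) (*-comm N _))
    m+m≤n+n⇒m≤n : ∀ {m n} → m + m ≤ n + n → m ≤ n
    m+m≤n+n⇒m≤n m+m≤n+n = ≮⇒≥ λ n<m → <⇒≱ (+-mono-< n<m n<m) m+m≤n+n

  cut-perturb-< : ∀ {X Y} → cut w X < cut w Y → cut (perturb w r N) X < cut (perturb w r N) Y
  cut-perturb-< {X} {Y} dX<dY = begin-strict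
    cut (perturb w r N) X    ≡⟨ cut-perturb w r N X ⟩
    k * cut w X + cut r X    ≤⟨ +-monoʳ-≤ (k * cut w X) (cut-r-≤ X) ⟩
    k * cut w X + k          ≡⟨ trans (+-comm (k * cut w X) k) (sym (*-suc k (cut w X))) ⟩
    k * suc (cut w X)        ≤⟨ *-monoʳ-≤ k dX<dY ⟩
    k * cut w Y              <⟨ m<m+n (k * cut w Y) (cut-positive w r (λ u v → proj₁ ∘ r-on u v) Y (≤-<-trans z≤n dX<dY)) ⟩
    k * cut w Y + cut r Y    ≡⟨ cut-perturb w r N Y ⟨
    cut (perturb w r N) Y    ∎
    where
    open ≤-Reasoning
    k : ℕ
    k = numEdges w * N

-- Runs of a traversal

infix 4 _⊆ᴸ_
_⊆ᴸ_ : List (Subset n) → List (Subset n) → Set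
F ⊆ᴸ G = ∀ {X} → X ∈L F → X ∈L G

∈-remove⁻ : X ∈L remove R F → X ∈L F × X ≢ R
∈-remove⁻ {R = R} = ∈-filter⁻ (λ X → ¬? (X ≟ˢ R))

∈-remove⁺ : X ∈L F → X ≢ R → X ∈L remove R F
∈-remove⁺ {R = R} = ∈-filter⁺ (λ X → ¬? (X ≟ˢ R))

Unique-++-∷⁻ : ∀ (pre : List A) {x y post} → Unique (pre ++ y ∷ post) → x ∈L pre → x ∉L post
Unique-++-∷⁻ (_ ∷ pre) (x∉rest ∷ _) (here refl) x∈post = All.lookup x∉rest (∈-++⁺ʳ pre (there x∈post)) refl
Unique-++-∷⁻ (_ ∷ pre) (_ ∷ unique) (there x∈pre) = Unique-++-∷⁻ pre unique x∈pre

record KeptVisit (cond : Subset n → List (Subset n) → Set) (F o F' : List (Subset n)) (X : Subset n) : Set where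
  field
    before after current : List (Subset n)
    order≡ : o ≡ before ++ X ∷ after
    kept : ¬ cond X current
    current⊆ : current ⊆ᴸ F
    rest : Run cond current after F'

module _ {cond : Subset n → List (Subset n) → Set} where

  Run-⊆ : Run cond F o F' → F' ⊆ᴸ F
  Run-⊆ done = id
  Run-⊆ (drop _ run) = proj₁ ∘ ∈-remove⁻ ∘ Run-⊆ run
  Run-⊆ (keep _ run) = Run-⊆ run

  Run-unvisited : Run cond F o F' → X ∈L F → X ∉L o → X ∈L F'
  Run-unvisited done X∈F _ = X∈F
  Run-unvisited (drop _ run) X∈F X∉o = Run-unvisited run (∈-remove⁺ X∈F (X∉o ∘ here)) (X∉o ∘ there)
  Run-unvisited (keep _ run) X∈F X∉o = Run-unvisited run X∈F (X∉o ∘ there)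

  Run-survives : Run cond F o F' → F ⊆ᴸ F₀ → X ∈L F → (∀ G → G ⊆ᴸ F₀ → ¬ cond X G) → X ∈L F'
  Run-survives done _ X∈F _ = X∈F
  Run-survives {X = X} (drop {R = R} c run) F⊆F₀ X∈F never with X ≟ˢ R
  ... | yes refl = contradiction c (never _ F⊆F₀)
  ... | no X≢R = Run-survives run (F⊆F₀ ∘ proj₁ ∘ ∈-remove⁻) (∈-remove⁺ X∈F X≢R) never
  Run-survives (keep _ run) F⊆F₀ X∈F never = Run-survives run F⊆F₀ X∈F never

  Run-unique : Run cond F o F' → Unique F → Unique F'
  Run-unique done unique = unique
  Run-unique (drop {R = R} _ run) unique = Run-unique run (Unique.filter⁺ (λ X → ¬? (X ≟ˢ R)) unique)
  Run-unique (keep _ run) unique = Run-unique run unique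

  KeptVisit-∷ : F ⊆ᴸ F₀ → KeptVisit cond F o F' X → KeptVisit cond F₀ (R ∷ o) F' X
  KeptVisit-∷ {R = R} F⊆F₀ v = record
    { before = R ∷ before ; after = after ; current = current ; order≡ = cong (R ∷_) order≡
    ; kept = kept ; current⊆ = F⊆F₀ ∘ current⊆ ; rest = rest }
    where open KeptVisit v

  Run-kept : Run cond F o F' → X ∈L F' → X ∈L o → KeptVisit cond F o F' X
  Run-kept {X = X} (drop {F = F} {R = R} c run) X∈F' X∈o with X ≟ˢ R | X∈o
  ... | yes refl | _ = contradiction refl (proj₂ (∈-remove⁻ {F = F} (Run-⊆ run X∈F')))
  ... | no X≢R | here X≡R = contradiction X≡R X≢R
  ... | no _ | there X∈o' = KeptVisit-∷ (proj₁ ∘ ∈-remove⁻) (Run-kept run X∈F' X∈o')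
  Run-kept {X = X} (keep {R = R} ¬c run) X∈F' X∈o with X ≟ˢ R | X∈o
  ... | yes refl | _ = record
    { before = [] ; after = _ ; current = _ ; order≡ = refl ; kept = ¬c ; current⊆ = id ; rest = run }
  ... | no X≢R | here X≡R = contradiction X≡R X≢R
  ... | no _ | there X∈o' = KeptVisit-∷ id (Run-kept run X∈F' X∈o')

child-exists : Z ∈L F → Z ⊂ R → ∃ λ C → IsChild F C R × Z ⊆ C
child-exists {Z = Z} = go Z (⊃-wellFounded Z)
  where
  go : ∀ Z → Acc _⊃_ Z → Z ∈L F → Z ⊂ R → ∃ λ C → IsChild F C R × Z ⊆ C
  go {F = F} {R = R} Z (acc rec) Z∈F Z⊂R with any? (λ Y → Z ⊂? Y ×-dec Y ⊂? R) F
  ... | yes between = let Y , Y∈F , Z⊂Y , Y⊂R = find between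
                          C , child , Y⊆C = go Y (rec Z⊂Y) Y∈F Y⊂R
                      in C , child , ⊆-trans (p⊂q⇒p⊆q Z⊂Y) Y⊆C
  ... | no ∄ = Z , (Z∈F , Z⊂R , λ Y Y∈F Z⊂Y Y⊂R → ∄ (lose Y∈F (Z⊂Y , Y⊂R))) , id

parent-exists : Z ∈L F → R ⊂ Z → ∃ λ P → IsParent F P R × P ⊆ Z
parent-exists {Z = Z} = go Z (⊂-wellFounded Z)
  where
  go : ∀ Z → Acc _⊂_ Z → Z ∈L F → R ⊂ Z → ∃ λ P → IsParent F P R × P ⊆ Z
  go {F = F} {R = R} Z (acc rec) Z∈F R⊂Z with any? (λ Y → R ⊂? Y ×-dec Y ⊂? Z) F
  ... | yes between = let Y , Y∈F , R⊂Y , Y⊂Z = find between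
                          P , parent , P⊆Y = go Y (rec Y⊂Z) Y∈F R⊂Y
                      in P , parent , ⊆-trans P⊆Y (p⊂q⇒p⊆q Y⊂Z)
  ... | no ∄ = Z , (Z∈F , R⊂Z , λ Y Y∈F R⊂Y Y⊂Z → ∄ (lose Y∈F (R⊂Y , Y⊂Z))) , id

-- cond1 and cond3 are both instances of ChildBelow.
ChildBelow : (Subset n → ℕ) → Subset n → List (Subset n) → Set
ChildBelow f R F = ∃ λ W → IsChild F W R × f W ≤ f R

ChildBelowFree : (Subset n → ℕ) → List (Subset n) → Set
ChildBelowFree f F = ∀ R → R ∈L F → ¬ ChildBelow f R F

-- A node kept at its visit still has no child below it at the end: its children at the
-- end were already in the family then, since all its descendants precede it.
postOrder-Run⇒ChildBelowFree : ∀ {f : Subset n → ℕ} → IsPostOrder F o → Unique F →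
                              Run (ChildBelow f) F o F' → ChildBelowFree f F'
postOrder-Run⇒ChildBelowFree {F = F} {o = o} {F' = F'} (o↭F , descendants) unique run R R∈F'
                             (W , (W∈F' , W⊂R , maximal) , fW≤fR) =
  kept (W , (Run-⊆ rest W∈F' , W⊂R , maximalInCurrent) , fW≤fR)
  where
  visit : KeptVisit (ChildBelow _) F o F' R
  visit = Run-kept run R∈F' (∈-resp-↭ (↭-sym o↭F) (Run-⊆ run R∈F'))
  open KeptVisit visit
  unique-o : Unique (before ++ R ∷ after)
  unique-o = subst Unique order≡ (Permutation.Unique-resp-↭ (setoid _) (↭⇒↭ₛ (↭-sym o↭F)) unique)
  descendant∈F' : ∀ {Z} → Z ∈L current → Z ⊂ R → Z ∈L F'
  descendant∈F' {Z} Z∈current Z⊂R with descendants before R after order≡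
  ... | a , b , before≡a++b , ∈b⇔ =
    Run-unvisited rest Z∈current (Unique-++-∷⁻ before unique-o
      (subst (Z ∈L_) (sym before≡a++b) (∈-++⁺ʳ a (Equivalence.from (∈b⇔ Z) (current⊆ Z∈current , Z⊂R)))))
  maximalInCurrent : ∀ Z → Z ∈L current → W ⊂ Z → ¬ Z ⊂ R
  maximalInCurrent Z Z∈current W⊂Z Z⊂R = maximal Z (descendant∈F' Z∈current Z⊂R) W⊂Z Z⊂R

ChildBelowFree⇒⊂-antitone : ∀ {f : Subset n → ℕ} → ChildBelowFree f F →
                            R ∈L F → Z ∈L F → Z ⊂ R → f R < f Z
ChildBelowFree⇒⊂-antitone {F = F} {R = R} {f = f} free = go R (⊂-wellFounded R)
  where
  go : ∀ R → Acc _⊂_ R → R ∈L F → Z ∈L F → Z ⊂ R → f R < f Z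
  go {Z = Z} R (acc rec) R∈F Z∈F Z⊂R with child-exists Z∈F Z⊂R
  ... | C , child@(C∈F , C⊂R , _) , Z⊆C = <-≤-trans fR<fC fC≤fZ
    where
    fR<fC : f R < f C
    fR<fC = ≰⇒> λ fC≤fR → free R R∈F (C , child , fC≤fR)
    fC≤fZ : f C ≤ f Z
    fC≤fZ with ⊆⇒≡⊎⊂ Z⊆C
    ... | inj₁ refl = ≤-refl
    ... | inj₂ Z⊂C = <⇒≤ (go C (rec C⊂R) C∈F Z∈F Z⊂C)

Run-cond2⇒terminals-grow : Run (cond2 T) F o F' → X ∈L F' → X ∈L o → Y ∈L F' → X ⊂ Y → ¬ Y ∩ T ⊆ X ∩ T
Run-cond2⇒terminals-grow run X∈F' X∈o Y∈F' X⊂Y Y∩T⊆X∩T =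
  let P , parent@(_ , X⊂P , _) , P⊆Y = parent-exists (Run-⊆ rest Y∈F') X⊂Y
  in kept (P , parent , cong ∣_∣ (⊆-antisym (⊆-trans (∩-monoˡ-⊆ P⊆Y) Y∩T⊆X∩T) (∩-monoˡ-⊆ (p⊂q⇒p⊆q X⊂P))))
  where open KeptVisit (Run-kept run X∈F' X∈o)

-- The three traversals

module Traversals {n} (w r : Weights n) (T : Subset n) (N : ℕ)
  (w-sym : Symmetric w) (w-loopless : ∀ u → w u u ≡ 0)
  (r-off : ∀ u v → w u v ≡ 0 → r u v ≡ 0) (r-on : ∀ u v → 0 < w u v → 1 ≤ r u v × r u v ≤ N)
  (L : List (Subset n)) (L-unique : Unique L) (L-steiner : All (SteinerCut T) L) (L-laminar : Laminar L)
  (L-supreme~ : ∀ R S → IsMu T (cut (perturb w r N)) R S → S ∈L L)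
  {o₁ F₁ o₂ F₂ o₃ F₃ : List (Subset n)}
  (po₁ : IsPostOrder L o₁) (run₁ : Run (cond1 (cut (perturb w r N))) L o₁ F₁)
  (po₂ : IsPostOrder F₁ o₂) (run₂ : Run (cond2 T) F₁ o₂ F₂)
  (po₃ : IsPostOrder F₂ o₃) (run₃ : Run (cond3 (cut w)) F₂ o₃ F₃) where

  open ≤-Reasoning

  d d~ : Subset n → ℕ
  d = cut w
  d~ = cut (perturb w r N)

  module D = Submodular T d (cut-submodular w)
  module D~ = Submodular T d~ (cut-submodular (perturb w r N))
  open Perturbation w r N w-sym w-loopless r-off r-on using (cut-perturb-<)

  ≤~⇒≤ : ∀ {X Y} → d~ X ≤ d~ Y → d X ≤ d Y
  ≤~⇒≤ {X} {Y} d~X≤d~Y = ≮⇒≥ λ dY<dX → <⇒≱ (cut-perturb-< {Y} {X} dY<dX) d~X≤d~Y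

  extreme⇒extreme~ : Extreme T d X → Extreme T d~ X
  extreme⇒extreme~ {X = X} (sX , below) = sX , λ Y sY Y⊂X → cut-perturb-< {X} {Y} (below Y sY Y⊂X)

  supreme-cut-≡ : D.Supreme R S → D~.Supreme R S~ → d S ≡ d S~
  supreme-cut-≡ {S = S} {S~ = S~} supS@(eS , S∩T≡R , _) (eS~ , S~∩T≡R , maxS~) = ≤-antisym
    (D.supreme-≤ supS (proj₁ eS~) S⊆S~ S~∩T≡R)
    (≤~⇒≤ {S~} {S} (D~.extreme-≤ eS~ (proj₁ eS) S⊆S~))
    where
    S⊆S~ : S ⊆ S~
    S⊆S~ = maxS~ S (extreme⇒extreme~ eS) S∩T≡R

  F₁⊆L : F₁ ⊆ᴸ L
  F₁⊆L = Run-⊆ run₁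

  F₂⊆F₁ : F₂ ⊆ᴸ F₁
  F₂⊆F₁ = Run-⊆ run₂

  F₃⊆F₂ : F₃ ⊆ᴸ F₂
  F₃⊆F₂ = Run-⊆ run₃

  steiner : X ∈L L → SteinerCut T X
  steiner = All.lookup L-steiner

  F₁-free : ChildBelowFree d~ F₁
  F₁-free = postOrder-Run⇒ChildBelowFree po₁ L-unique run₁

  F₃-free : ChildBelowFree d F₃
  F₃-free = postOrder-Run⇒ChildBelowFree po₃ (Run-unique run₂ (Run-unique run₁ L-unique)) run₃

  supreme~∈L : D~.Supreme R M → M ∈L L
  supreme~∈L supM = L-supreme~ _ _ (D~.Supreme⇒IsMu supM)

  supreme~∈F₁ : D~.Supreme R M → M ∈L F₁
  supreme~∈F₁ supM@(eM , _) = Run-survives run₁ id (supreme~∈L supM)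
    λ G G⊆L (W , (W∈G , W⊂M , _) , d~W≤d~M) → <⇒≱ (proj₂ eM W (steiner (G⊆L W∈G)) W⊂M) d~W≤d~M

  supreme~∈F₂ : D~.Supreme R M → M ∈L F₂
  supreme~∈F₂ {R = R} {M = M} supM@(eM , M∩T≡R , _) = Run-survives run₂ id (supreme~∈F₁ supM) never
    where
    never : ∀ G → G ⊆ᴸ F₁ → ¬ cond2 T M G
    never G G⊆F₁ (W , (W∈G , M⊂W , _) , ∣W∩T∣≡∣M∩T∣) = <⇒≱
      (ChildBelowFree⇒⊂-antitone F₁-free (G⊆F₁ W∈G) (supreme~∈F₁ supM) M⊂W)
      (D~.supreme-≤ supM (steiner (F₁⊆L (G⊆F₁ W∈G))) (p⊂q⇒p⊆q M⊂W) W∩T≡R)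
      where
      W∩T≡R : W ∩ T ≡ R
      W∩T≡R = trans (sym (⊆∧∣≡∣⇒≡ (∩-monoˡ-⊆ (p⊂q⇒p⊆q M⊂W)) (sym ∣W∩T∣≡∣M∩T∣))) M∩T≡R

  ∈F₂⇒supreme~ : X ∈L F₂ → D~.Supreme (X ∩ T) X
  ∈F₂⇒supreme~ {X} X∈F₂ =
    let Z , eZ@(((t , t∈Z∩T) , _) , _) , Z⊆X , d~Z≤d~X = D~.extreme-below (steiner (F₁⊆L X∈F₁))
        M , supM@(eM , M∩T≡Z∩T , _) , Z⊆M = D~.supreme-above eZ refl
        M⊄X : ¬ M ⊂ X
        M⊄X M⊂X = <⇒≱ (ChildBelowFree⇒⊂-antitone F₁-free X∈F₁ (supreme~∈F₁ supM) M⊂X)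
                      (≤-trans (D~.extreme-≤ eM (proj₁ eZ) Z⊆M) d~Z≤d~X)
        X⊄M : ¬ X ⊂ M
        X⊄M X⊂M = Run-cond2⇒terminals-grow run₂ X∈F₂ (∈-resp-↭ (↭-sym (proj₁ po₂)) X∈F₁) (supreme~∈F₂ supM) X⊂M
                    (subst (_⊆ X ∩ T) (sym M∩T≡Z∩T) (∩-monoˡ-⊆ Z⊆X))
        M∩X-nonempty : ¬ Empty (M ∩ X)
        M∩X-nonempty M∩X-empty = M∩X-empty (t , ∈-∩⁺ (Z⊆M (∩-⊆ˡ t∈Z∩T)) (Z⊆X (∩-⊆ˡ t∈Z∩T)))
        M≡X : M ≡ X
        M≡X = [ (λ (M⊆X : M ⊆ X) → ⊆∧⊄⇒≡ M⊆X M⊄X)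
              , [ (λ (X⊆M : X ⊆ M) → sym (⊆∧⊄⇒≡ X⊆M X⊄M)) , ⊥-elim ∘ M∩X-nonempty ]′
              ]′ (L-laminar M X (supreme~∈L supM) (F₁⊆L X∈F₁))
    in subst (λ Q → D~.Supreme (Q ∩ T) Q) M≡X (D~.Supreme-own-terminals supM)
    where
    X∈F₁ : X ∈L F₁
    X∈F₁ = F₂⊆F₁ X∈F₂

  supreme⇒supreme~∈F₃ : D.Supreme R S → ∃ λ M → D~.Supreme R M × S ⊆ M × M ∈L F₃
  supreme⇒supreme~∈F₃ {R = R} {S = S} (eS , S∩T≡R , _) with D~.supreme-above (extreme⇒extreme~ eS) S∩T≡R
  ... | M , supM@(eM , M∩T≡R , _) , S⊆M = M , supM , S⊆M , Run-survives run₃ id (supreme~∈F₂ supM) never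
    where
    never : ∀ G → G ⊆ᴸ F₂ → ¬ cond3 d M G
    never G G⊆F₂ (W , (W∈G , (W⊆M , x , x∈M , x∉W) , _) , dW≤dM) =
      ¬S⊈W (proj₁ (proj₁ (proj₁ supW))) S⊈W
      where
      supW : D~.Supreme (W ∩ T) W
      supW = ∈F₂⇒supreme~ (G⊆F₂ W∈G)
      S⊈W : ¬ S ⊆ W
      S⊈W S⊆W = x∉W (proj₂ (proj₂ supW) M eM (trans M∩T≡R (sym W∩T≡R)) x∈M)
        where
        W∩T≡R : W ∩ T ≡ R
        W∩T≡R = D.terminals-between S⊆W W⊆M S∩T≡R M∩T≡R
      ¬S⊈W : Nonempty (W ∩ T) → ¬ ¬ S ⊆ W
      ¬S⊈W (t , t∈W∩T) S⊈W = <⇒≱ (begin-strict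
        d M        ≤⟨ ≤~⇒≤ {M} {S ∪ W} (D~.extreme-≤ eM sS∪W S∪W⊆M) ⟩
        d (S ∪ W)  <⟨ D.uncross eS t∈S (∩-⊆ˡ t∈W∩T) (∩-⊆ʳ t∈W∩T) S⊈W ⟩
        d W        ∎) dW≤dM
        where
        S∪W⊆M : S ∪ W ⊆ M
        S∪W⊆M = ∪-lub S⊆M W⊆M
        sS∪W : SteinerCut T (S ∪ W)
        sS∪W = D.steinerCut-between ∪-⊆ˡ S∪W⊆M (proj₁ eS) (proj₁ eM)
        t∈S : t ∈ S
        t∈S = ∩-⊆ˡ (subst (t ∈_) (trans M∩T≡R (sym S∩T≡R)) (∩-monoˡ-⊆ W⊆M t∈W∩T))

  extreme-below-F₃⇒terminals-≡ : ∀ {Z} → X ∈L F₃ → Extreme T d Z → Z ⊆ X → d Z ≤ d X → Z ∩ T ≡ X ∩ T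
  extreme-below-F₃⇒terminals-≡ {X} {Z} X∈F₃ eZ@(((t , t∈Z∩T) , _) , _) Z⊆X dZ≤dX =
    decidable-stable (Z ∩ T ≟ˢ X ∩ T) λ Z∩T≢X∩T →
      let S , supS@(eS , _) , Z⊆S = D.supreme-above eZ refl
          M , supM@(_ , M∩T≡Z∩T , _) , S⊆M , M∈F₃ = supreme⇒supreme~∈F₃ supS
          X⊈M : ¬ X ⊆ M
          X⊈M X⊆M = Z∩T≢X∩T (⊆-antisym (∩-monoˡ-⊆ Z⊆X) (subst (X ∩ T ⊆_) M∩T≡Z∩T (∩-monoˡ-⊆ X⊆M)))
          dM≤dX : d M ≤ d X
          dM≤dX = begin
            d M  ≡⟨ supreme-cut-≡ supS supM ⟨
            d S  ≤⟨ D.extreme-≤ eS (proj₁ eZ) Z⊆S ⟩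
            d Z  ≤⟨ dZ≤dX ⟩
            d X  ∎
          M⊈X : ¬ M ⊆ X
          M⊈X M⊆X = <⇒≱ (ChildBelowFree⇒⊂-antitone F₃-free X∈F₃ M∈F₃ (M⊆X , ⊈⇒∃∉ X⊈M)) dM≤dX
          M∩X-nonempty : ¬ Empty (M ∩ X)
          M∩X-nonempty M∩X-empty = M∩X-empty (t , ∈-∩⁺ (⊆-trans Z⊆S S⊆M (∩-⊆ˡ t∈Z∩T)) (Z⊆X (∩-⊆ˡ t∈Z∩T)))
      in [ M⊈X , [ X⊈M , M∩X-nonempty ]′ ]′ (L-laminar M X (supreme~∈L supM) (F₁⊆L (F₂⊆F₁ (F₃⊆F₂ X∈F₃))))

  ∈F₃⇒supreme : X ∈L F₃ → ∃ λ S → D.Supreme (X ∩ T) S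
  ∈F₃⇒supreme X∈F₃ =
    let Z , eZ , Z⊆X , dZ≤dX = D.extreme-below (steiner (F₁⊆L (F₂⊆F₁ (F₃⊆F₂ X∈F₃))))
        S , supS , _ = D.supreme-above eZ (extreme-below-F₃⇒terminals-≡ X∈F₃ eZ Z⊆X dZ≤dX)
    in S , supS

mainTheorem15 : ∀ (n : ℕ) (w r : Weights n) (T : Subset n) (N : ℕ) →
    Symmetric w → (∀ u → w u u ≡ 0) →
    Symmetric r →
    (∀ u v → w u v ≡ 0 → r u v ≡ 0) →
    (∀ u v → 0 < w u v → 1 ≤ r u v × r u v ≤ N) →
    totalWeight w < N →
    (L : List (Subset n)) →
    Unique L →
    All (SteinerCut T) L →
    Laminar L →
    (∀ R S → IsMu T (cut (perturb w r N)) R S → S ∈L L) →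
    ∀ (o1 F1 o2 F2 o3 F3 : List (Subset n)) →
    IsPostOrder L o1 → Run (cond1 (cut (perturb w r N))) L o1 F1 →
    IsPostOrder F1 o2 → Run (cond2 T) F1 o2 F2 →
    IsPostOrder F2 o3 → Run (cond3 (cut w)) F2 o3 F3 →
    ((∀ X → X ∈L F3 →
        ∃ λ R → (∃ λ S → IsMu T (cut w) R S) × IsMu T (cut (perturb w r N)) R X) ×
     (∀ R S → IsMu T (cut w) R S →
        ∃ λ X → IsMu T (cut (perturb w r N)) R X × X ∈L F3)) ×
    (∀ R S S~ → IsMu T (cut w) R S → IsMu T (cut (perturb w r N)) R S~ →
        cut w S ≡ cut w S~)
mainTheorem15 n w r T N w-sym w-loopless _ r-off r-on _ L L-unique L-steiner L-laminar L-supreme~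
              _ _ _ _ _ F₃ po₁ run₁ po₂ run₂ po₃ run₃ =
  ( (λ X X∈F₃ → X ∩ T
               , map₂ D.Supreme⇒IsMu (∈F₃⇒supreme X∈F₃)
               , D~.Supreme⇒IsMu (∈F₂⇒supreme~ (F₃⊆F₂ X∈F₃)))
  , (λ R S μRS → let M , supM , _ , M∈F₃ = supreme⇒supreme~∈F₃ (D.IsMu⇒Supreme μRS)
                 in M , D~.Supreme⇒IsMu supM , M∈F₃) )
  , λ R S S~ μRS μ~RS~ → supreme-cut-≡ (D.IsMu⇒Supreme μRS) (D~.IsMu⇒Supreme μ~RS~)
  where
  open Traversals w r T N w-sym w-loopless r-off r-on L L-unique L-steiner L-laminar L-supreme~
                  po₁ run₁ po₂ run₂ po₃ run₃
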